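{- For every algebraic dcpo $D$ (over base universe $\mathcal{U}$), the poset of Scott open subsets of $D$ ordered by inclusion forms a frame: it has finite meets (full subset and intersection), joins of small families (unions), the inclusion order has $\mathcal{U}$-small truth values, and binary meets distribute over small joins.
   Context: Setting: univalent type theory with universes, function and propositional extensionality, propositional truncations. Fix base universe $\mathcal{U}$; small means equivalent to a type in $\mathcal{U}$. A dcpo $D$ consists of a type $|D|$ in $\mathcal{U}^+$, a partial order $\sqsubseteq$ valued in $\Omega_{\mathcal{U}}$, and least upper bounds $\bigsqcup_{i:I} x_i$ of all directed families with $I:\mathcal{U}$ (directed: $I$ inhabited and any two members have an upper bound in the family). An element $c$ is finite if for every small directed family with $c \sqsubseteq \bigsqcup x_i$ there exists $i$ with $c\sqsubseteq x_i$. $D$ is algebraic if (AD1) for every $x$, the family of finite elements below $x$ is directed with join $x$, and (AD2) the type of finite elements is small. A subset $S : D\to\Omega_{\mathcal{U}}$ is Scott open if it is upward closed and for every small directed family $(x_i)$ with $\bigsqcup x_i\in S$ there exists $i$ with $x_i\in S$. -}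

module Defs where

open import Level using (Level; _⊔_; Setω) renaming (suc to lsuc)
open import Data.Product using (Σ; _×_; _,_; proj₁; proj₂)
open import Relation.Binary.PropositionalEquality using (_≡_)

is-prop : ∀ {ℓ} → Set ℓ → Set ℓ
is-prop A = (x y : A) → x ≡ y

is-set : ∀ {ℓ} → Set ℓ → Set ℓ
is-set A = (x y : A) → is-prop (x ≡ y)

record _≃_ {a b} (A : Set a) (B : Set b) : Set (a ⊔ b) where
  field
    to      : A → B
    from    : B → A
    from-to : ∀ x → from (to x) ≡ x
    to-from : ∀ y → to (from y) ≡ y

is-small : ∀ {ℓ} (𝓤 : Level) → Set ℓ → Set (lsuc 𝓤 ⊔ ℓ)
is-small 𝓤 X = Σ (Set 𝓤) (λ Y → Y ≃ X)

FunExt : Setω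
FunExt = ∀ {a b} {A : Set a} {B : A → Set b} {f g : (x : A) → B x}
         → (∀ x → f x ≡ g x) → f ≡ g

PropExt : Setω
PropExt = ∀ {ℓ} {P Q : Set ℓ} → is-prop P → is-prop Q
          → (P → Q) → (Q → P) → P ≡ Q

record PropTrunc : Setω where
  field
    ∥_∥       : ∀ {ℓ} → Set ℓ → Set ℓ
    ∥∥-is-prop : ∀ {ℓ} {A : Set ℓ} → is-prop ∥ A ∥
    ∣_∣       : ∀ {ℓ} {A : Set ℓ} → A → ∥ A ∥
    ∥∥-rec    : ∀ {ℓ ℓ'} {A : Set ℓ} {P : Set ℓ'}
                → is-prop P → (A → P) → ∥ A ∥ → P

record IsFrame {a b} (𝓤 : Level) (A : Set a) (_≤_ : A → A → Set b)
               (𝟏 : A) (_∧_ : A → A → A)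
               (⋁ : {I : Set 𝓤} → (I → A) → A)
               : Set (a ⊔ b ⊔ lsuc 𝓤) where
  field
    carrier-is-set : is-set A
    ≤-prop    : ∀ x y → is-prop (x ≤ y)
    ≤-refl    : ∀ x → x ≤ x
    ≤-trans   : ∀ x y z → x ≤ y → y ≤ z → x ≤ z
    ≤-antisym : ∀ x y → x ≤ y → y ≤ x → x ≡ y
    ≤-small   : ∀ x y → is-small 𝓤 (x ≤ y)
    𝟏-top     : ∀ x → x ≤ 𝟏
    ∧-lb₁     : ∀ x y → (x ∧ y) ≤ x
    ∧-lb₂     : ∀ x y → (x ∧ y) ≤ y
    ∧-glb     : ∀ z x y → z ≤ x → z ≤ y → z ≤ (x ∧ y)
    ⋁-ub      : ∀ {I : Set 𝓤} (α : I → A) (i : I) → α i ≤ ⋁ α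
    ⋁-least   : ∀ {I : Set 𝓤} (α : I → A) (u : A)
                → (∀ i → α i ≤ u) → ⋁ α ≤ u
    distrib   : ∀ x {I : Set 𝓤} (α : I → A) → (x ∧ ⋁ α) ≡ ⋁ (λ i → x ∧ α i)

module WithTrunc (pt : PropTrunc) where
  open PropTrunc pt

  is-directed : ∀ {a b c} {X : Set a} (_≤_ : X → X → Set b) {I : Set c}
                → (I → X) → Set (b ⊔ c)
  is-directed _≤_ {I} α =
    ∥ I ∥ × (∀ i j → ∥ Σ I (λ k → (α i ≤ α k) × (α j ≤ α k)) ∥)

  is-upperbound : ∀ {a b c} {X : Set a} (_≤_ : X → X → Set b) {I : Set c}
                  → (I → X) → X → Set (b ⊔ c)
  is-upperbound _≤_ α x = ∀ i → α i ≤ x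

  is-sup : ∀ {a b c} {X : Set a} (_≤_ : X → X → Set b) {I : Set c}
           → (I → X) → X → Set (a ⊔ b ⊔ c)
  is-sup _≤_ α x = is-upperbound _≤_ α x
                   × (∀ y → is-upperbound _≤_ α y → x ≤ y)

  record DCPO (𝓤 : Level) : Set (lsuc (lsuc 𝓤)) where
    field
      ∣D∣       : Set (lsuc 𝓤)
      _⊑_       : ∣D∣ → ∣D∣ → Set 𝓤
      ∣D∣-is-set : is-set ∣D∣
      ⊑-prop    : ∀ x y → is-prop (x ⊑ y)
      ⊑-refl    : ∀ x → x ⊑ x
      ⊑-trans   : ∀ x y z → x ⊑ y → y ⊑ z → x ⊑ z
      ⊑-antisym : ∀ x y → x ⊑ y → y ⊑ x → x ≡ y
      ∐         : {I : Set 𝓤} (α : I → ∣D∣) → is-directed _⊑_ α → ∣D∣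
      ∐-is-sup  : {I : Set 𝓤} (α : I → ∣D∣) (δ : is-directed _⊑_ α)
                  → is-sup _⊑_ α (∐ α δ)

  module _ {𝓤 : Level} (D : DCPO 𝓤) where
    open DCPO D

    is-finite : ∣D∣ → Set (lsuc 𝓤)
    is-finite c = ∀ {I : Set 𝓤} (α : I → ∣D∣) (δ : is-directed _⊑_ α)
                  → c ⊑ ∐ α δ → ∥ Σ I (λ i → c ⊑ α i) ∥

    AD1 : Set (lsuc 𝓤)
    AD1 = ∀ x → is-directed _⊑_ {Σ ∣D∣ (λ c → is-finite c × (c ⊑ x))} proj₁
              × is-sup _⊑_ {Σ ∣D∣ (λ c → is-finite c × (c ⊑ x))} proj₁ x

    AD2 : Set (lsuc 𝓤)
    AD2 = is-small 𝓤 (Σ ∣D∣ is-finite)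

    is-algebraic : Set (lsuc 𝓤)
    is-algebraic = AD1 × AD2

    record ScottOpen : Set (lsuc 𝓤) where
      field
        _∋_       : ∣D∣ → Set 𝓤
        ∋-prop    : ∀ x → is-prop (_∋_ x)
        up-closed : ∀ x y → x ⊑ y → _∋_ x → _∋_ y
        inacc     : ∀ {I : Set 𝓤} (α : I → ∣D∣) (δ : is-directed _⊑_ α)
                    → _∋_ (∐ α δ) → ∥ Σ I (λ i → _∋_ (α i)) ∥

    open ScottOpen public

    _⊆_ : ScottOpen → ScottOpen → Set (lsuc 𝓤)
    U ⊆ V = ∀ x → (U ∋ x) → (V ∋ x)

    record ScottFrame : Set (lsuc (lsuc 𝓤)) where
      field
        full       : ScottOpen
        full-is-full : ∀ x → full ∋ x
        _∩_        : ScottOpen → ScottOpen → ScottOpen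
        ∩-is-inter : ∀ U V x → (((U ∩ V) ∋ x) → (U ∋ x) × (V ∋ x))
                                × ((U ∋ x) × (V ∋ x) → (U ∩ V) ∋ x)
        ⋃          : {I : Set 𝓤} → (I → ScottOpen) → ScottOpen
        ⋃-is-union : ∀ {I : Set 𝓤} (W : I → ScottOpen) x
                     → ((⋃ W ∋ x) → ∥ Σ I (λ i → W i ∋ x) ∥)
                       × (∥ Σ I (λ i → W i ∋ x) ∥ → ⋃ W ∋ x)
        is-frame   : IsFrame 𝓤 ScottOpen _⊆_ full _∩_ ⋃

{-# OPTIONS --safe #-}
-- Scott opens are closed under finite intersections (by directedness) and
-- under arbitrary unions, and distributivity holds pointwise; with function
-- and propositional extensionality a Scott open is determined by its
-- proposition-valued membership, so inclusion is antisymmetric and the opens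
-- form a set. The one point needing algebraicity is smallness of inclusion:
-- every x is the directed join of the finite elements below it, so by
-- inaccessibility a Scott open containing x contains a finite element below
-- x. Hence U ⊆ V iff every finite element of U lies in V, a statement that
-- quantifies only over the small type of finite elements.
module Submission where

open import Defs
open import Axiom.UniquenessOfIdentityProofs using (module Constant⇒UIP)
open import Data.Product using (Σ; _×_; _,_; proj₁; proj₂)
open import Data.Unit.Polymorphic using (⊤; tt)
open import Function using (_∘_; id)
open import Level using (Level) renaming (suc to lsuc)
open import Relation.Binary.PropositionalEquality using (_≡_; refl; sym; cong; cong₂; subst)

prop-is-set : ∀ {a} {A : Set a} → is-prop A → is-set A
prop-is-set A-prop _ _ =
  Constant⇒UIP.≡-irrelevant (λ {x} {y} _ → A-prop x y) (λ _ _ → refl)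

is-prop-is-prop : FunExt → ∀ {a} {A : Set a} → is-prop (is-prop A)
is-prop-is-prop fe h h' = fe λ x → fe λ y → prop-is-set h x y (h x y) (h' x y)

implicit-funext : FunExt → ∀ {a b} {A : Set a} {B : A → Set b} {f g : ∀ {x} → B x}
                → (∀ x → f {x} ≡ g {x}) → (λ {x} → f {x}) ≡ (λ {x} → g {x})
implicit-funext fe f≗g = cong (λ h → λ {x} → h x) (fe f≗g)

module _ (pt : PropTrunc) where
  open PropTrunc pt
  open WithTrunc pt hiding (_⊆_)

  ∥∥-map : ∀ {a b} {A : Set a} {B : Set b} → (A → B) → ∥ A ∥ → ∥ B ∥
  ∥∥-map f = ∥∥-rec ∥∥-is-prop (∣_∣ ∘ f)

  module _ {a b c d} {X : Set a} (_≤_ : X → X → Set b) {I : Set c} {J : Set d}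
           (α : I → X) (s : J → I) (r : I → J) (α-s∘r : ∀ i → α (s (r i)) ≡ α i)
           where

    is-directed-∘ : is-directed _≤_ α → is-directed _≤_ (α ∘ s)
    is-directed-∘ (inhabited , bounded) =
      ∥∥-map r inhabited ,
      λ j j' → ∥∥-map (λ { (k , jk , j'k) →
                            r k , subst (α (s j) ≤_) (sym (α-s∘r k)) jk
                                , subst (α (s j') ≤_) (sym (α-s∘r k)) j'k })
                       (bounded (s j) (s j'))

    is-sup-∘ : ∀ {x} → is-sup _≤_ α x → is-sup _≤_ (α ∘ s) x
    is-sup-∘ (upper , least) =
      upper ∘ s ,
      λ y y-upper → least y (λ i → subst (_≤ y) (α-s∘r i) (y-upper (r i)))

  module _ {𝓤 : Level} (D : DCPO 𝓤) where
    open DCPO D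

    _⊆_ : ScottOpen D → ScottOpen D → Set (lsuc 𝓤)
    _⊆_ = WithTrunc._⊆_ pt D

    full : ScottOpen D
    full = record
      { _∋_       = λ _ → ⊤
      ; ∋-prop    = λ _ _ _ → refl
      ; up-closed = λ _ _ _ _ → tt
      ; inacc     = λ _ (inhabited , _) _ → ∥∥-map (_, tt) inhabited
      }

    _∩_ : ScottOpen D → ScottOpen D → ScottOpen D
    U ∩ V = record
      { _∋_       = λ x → (U ∋ x) × (V ∋ x)
      ; ∋-prop    = λ x _ _ → cong₂ _,_ (∋-prop U x _ _) (∋-prop V x _ _)
      ; up-closed = λ x y x⊑y (x∈U , x∈V) → up-closed U x y x⊑y x∈U , up-closed V x y x⊑y x∈V
      ; inacc     = inacc-∩
      }
      where
      inacc-∩ : ∀ {I : Set 𝓤} (α : I → ∣D∣) (δ : is-directed _⊑_ α)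
              → (U ∋ ∐ α δ) × (V ∋ ∐ α δ) → ∥ Σ I (λ k → (U ∋ α k) × (V ∋ α k)) ∥
      inacc-∩ α δ@(_ , bounded) (∐∈U , ∐∈V) =
        ∥∥-rec ∥∥-is-prop (λ { (i , αi∈U) →
        ∥∥-rec ∥∥-is-prop (λ { (j , αj∈V) →
        ∥∥-map (λ { (k , i⊑k , j⊑k) →
                     k , up-closed U (α i) (α k) i⊑k αi∈U , up-closed V (α j) (α k) j⊑k αj∈V })
               (bounded i j) })
        (inacc V α δ ∐∈V) })
        (inacc U α δ ∐∈U)

    ⋃ : {I : Set 𝓤} → (I → ScottOpen D) → ScottOpen D
    ⋃ {I} W = record
      { _∋_       = λ x → ∥ Σ I (λ i → W i ∋ x) ∥
      ; ∋-prop    = λ _ → ∥∥-is-prop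
      ; up-closed = λ x y x⊑y → ∥∥-map (λ { (i , x∈Wi) → i , up-closed (W i) x y x⊑y x∈Wi })
      ; inacc     = λ α δ → ∥∥-rec ∥∥-is-prop (λ { (i , ∐∈Wi) →
                      ∥∥-map (λ { (j , αj∈Wi) → j , ∣ i , αj∈Wi ∣ }) (inacc (W i) α δ ∐∈Wi) })
      }

    module _ (alg : is-algebraic D) where
      Basis : Set 𝓤
      Basis = proj₁ (proj₂ alg)

      open _≃_ (proj₂ (proj₂ alg))

      basis : Basis → ∣D∣
      basis k = proj₁ (to k)

      basis-from : ∀ c (c-finite : is-finite D c) → basis (from (c , c-finite)) ≡ c
      basis-from c c-finite = cong proj₁ (to-from (c , c-finite))

      Approximants : ∣D∣ → Set 𝓤
      Approximants x = Σ Basis (λ k → basis k ⊑ x)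

      approximant : {x : ∣D∣} → Approximants x → ∣D∣
      approximant = basis ∘ proj₁

      -- The small family of approximants reindexes the large family of AD1.
      module _ (x : ∣D∣) where
        private
          Finite↓ : Set (lsuc 𝓤)
          Finite↓ = Σ ∣D∣ (λ c → is-finite D c × (c ⊑ x))

          include : Approximants x → Finite↓
          include (k , k⊑x) = basis k , proj₂ (to k) , k⊑x

          select : Finite↓ → Approximants x
          select (c , c-finite , c⊑x) =
            from (c , c-finite) , subst (_⊑ x) (sym (basis-from c c-finite)) c⊑x

          include-select : ∀ c → proj₁ (include (select c)) ≡ proj₁ c
          include-select (c , c-finite , _) = basis-from c c-finite

        approximants-directed : is-directed _⊑_ (approximant {x})
        approximants-directed =
          is-directed-∘ _⊑_ proj₁ include select include-select (proj₁ (proj₁ alg x))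

        approximants-sup : is-sup _⊑_ (approximant {x}) x
        approximants-sup =
          is-sup-∘ _⊑_ proj₁ include select include-select (proj₂ (proj₁ alg x))

      ∋-approximant : ∀ (U : ScottOpen D) {x} → U ∋ x
                    → ∥ Σ (Approximants x) (λ j → U ∋ approximant j) ∥
      ∋-approximant U {x} x∈U =
        inacc U approximant δ (up-closed U x (∐ approximant δ) x⊑∐ x∈U)
        where
        δ = approximants-directed x
        x⊑∐ = proj₂ (approximants-sup x) _ (proj₁ (∐-is-sup approximant δ))

      ⊆-from-basis : ∀ U V → (∀ k → U ∋ basis k → V ∋ basis k) → U ⊆ V
      ⊆-from-basis U V basis-incl x x∈U =
        ∥∥-rec (∋-prop V x)
               (λ { ((k , k⊑x) , k∈U) → up-closed V (basis k) x k⊑x (basis-incl k k∈U) })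
               (∋-approximant U x∈U)

    module _ (fe : FunExt) (pe : PropExt) where
      ∋-injective : {U V : ScottOpen D} → _∋_ U ≡ _∋_ V → U ≡ V
      ∋-injective {record { _∋_ = S ; ∋-prop = p ; up-closed = u ; inacc = i }}
                  {record { ∋-prop = p' ; up-closed = u' ; inacc = i' }} refl =
        fields-≡ (fe λ x → is-prop-is-prop fe (p x) (p' x))
                 (fe λ x → fe λ y → fe λ _ → fe λ _ → p y _ _)
                 (implicit-funext fe λ _ → fe λ _ → fe λ _ → fe λ _ → ∥∥-is-prop _ _)
        where
        fields-≡ : p ≡ p' → u ≡ u' → (λ {I} → i {I}) ≡ (λ {I} → i' {I})
                 → _≡_ {A = ScottOpen D}
                     (record { _∋_ = S ; ∋-prop = p ; up-closed = u ; inacc = i })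
                     (record { _∋_ = S ; ∋-prop = p' ; up-closed = u' ; inacc = i' })
        fields-≡ refl refl refl = refl

      ⊆-prop : ∀ U V → is-prop (U ⊆ V)
      ⊆-prop U V _ _ = fe λ x → fe λ _ → ∋-prop V x _ _

      ⊆-antisym : ∀ U V → U ⊆ V → V ⊆ U → U ≡ V
      ⊆-antisym U V U⊆V V⊆U =
        ∋-injective (fe λ x → pe (∋-prop U x) (∋-prop V x) (U⊆V x) (V⊆U x))

      ScottOpen-is-set : is-set (ScottOpen D)
      ScottOpen-is-set _ _ = Constant⇒UIP.≡-irrelevant collapse collapse-constant
        where
        ≡⇒⊆ : {U V : ScottOpen D} → U ≡ V → U ⊆ V
        ≡⇒⊆ refl _ x∈U = x∈U

        collapse : {U V : ScottOpen D} → U ≡ V → U ≡ V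
        collapse {U} {V} U≡V = ⊆-antisym U V (≡⇒⊆ U≡V) (≡⇒⊆ (sym U≡V))

        collapse-constant : {U V : ScottOpen D} (p q : U ≡ V) → collapse p ≡ collapse q
        collapse-constant {U} {V} _ _ =
          cong₂ (⊆-antisym U V) (⊆-prop U V _ _) (⊆-prop V U _ _)

      ⊆-small : is-algebraic D → ∀ U V → is-small 𝓤 (U ⊆ V)
      ⊆-small alg U V = ((k : Basis alg) → U ∋ basis alg k → V ∋ basis alg k) , record
        { to      = ⊆-from-basis alg U V
        ; from    = λ U⊆V k → U⊆V (basis alg k)
        ; from-to = λ _ → fe λ k → fe λ _ → ∋-prop V (basis alg k) _ _
        ; to-from = λ _ → ⊆-prop U V _ _
        }

      ∩-⋃-distrib : ∀ U {I : Set 𝓤} (W : I → ScottOpen D) → (U ∩ ⋃ W) ≡ ⋃ (λ i → U ∩ W i)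
      ∩-⋃-distrib U W = ⊆-antisym (U ∩ ⋃ W) (⋃ (λ i → U ∩ W i))
        (λ _ (x∈U , x∈⋃W) → ∥∥-map (λ { (i , x∈Wi) → i , x∈U , x∈Wi }) x∈⋃W)
        (λ x → ∥∥-rec (∋-prop (U ∩ ⋃ W) x) (λ { (i , x∈U , x∈Wi) → x∈U , ∣ i , x∈Wi ∣ }))

      ScottOpen-is-frame : is-algebraic D → IsFrame 𝓤 (ScottOpen D) _⊆_ full _∩_ ⋃
      ScottOpen-is-frame alg = record
        { carrier-is-set = ScottOpen-is-set
        ; ≤-prop    = ⊆-prop
        ; ≤-refl    = λ _ _ x∈U → x∈U
        ; ≤-trans   = λ _ _ _ U⊆V V⊆W x x∈U → V⊆W x (U⊆V x x∈U)
        ; ≤-antisym = ⊆-antisym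
        ; ≤-small   = ⊆-small alg
        ; 𝟏-top     = λ _ _ _ → tt
        ; ∧-lb₁     = λ _ _ _ → proj₁
        ; ∧-lb₂     = λ _ _ _ → proj₂
        ; ∧-glb     = λ _ _ _ W⊆U W⊆V x x∈W → W⊆U x x∈W , W⊆V x x∈W
        ; ⋁-ub      = λ _ i _ x∈Wi → ∣ i , x∈Wi ∣
        ; ⋁-least   = λ _ U Wi⊆U x → ∥∥-rec (∋-prop U x) (λ { (i , x∈Wi) → Wi⊆U i x x∈Wi })
        ; distrib   = ∩-⋃-distrib
        }

mainTheorem13 : (pt : PropTrunc) → FunExt → PropExt
                → ∀ {𝓤} (D : WithTrunc.DCPO pt 𝓤)
                → WithTrunc.is-algebraic pt D
                → WithTrunc.ScottFrame pt D
mainTheorem13 pt fe pe D alg = record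
  { full         = full pt D
  ; full-is-full = λ _ → tt
  ; _∩_          = _∩_ pt D
  ; ∩-is-inter   = λ _ _ _ → id , id
  ; ⋃            = ⋃ pt D
  ; ⋃-is-union   = λ _ _ → id , id
  ; is-frame     = ScottOpen-is-frame pt D fe pe alg
  }
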